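{- For all $l,q,s\in\mathbb{N}$, there is a constant $\sigma=\sigma(l,q,s)\in\mathbb{N}$ with the following property. Let $G$ be a graph and let $\mathcal{P}$ be a $\sigma$-polypath in $G$. Then one of the following holds: (a) there exists an $(s,l)$-cluster $(S,\mathcal{L})$ in $G$ with $S\subseteq V(\mathcal{P})$ and $\mathcal{L}\subseteq\mathcal{P}$; (b) there exists an $l$-loose $q$-polypath $\mathcal{Q}$ in $G$ with $\mathcal{Q}\subseteq\mathcal{P}$.
   Context: A path in $G$ is an induced subgraph that is a path. A $w$-polypath in $G$ is a set $\mathcal{W}$ of $w$ pairwise disjoint paths in $G$; $V(\mathcal{W})$ is the union of their vertex sets. $\mathcal{W}$ is $d$-loose if for every $W\in\mathcal{W}$, each vertex of $W$ has neighbors in fewer than $d$ paths of $\mathcal{W}\setminus\{W\}$. An $(s,l)$-cluster in $G$ is a pair $(S,\mathcal{L})$ with $S\subseteq V(G)$, $|S|=s$, and $\mathcal{L}$ an $l$-polypath in $G\setminus S$ such that every vertex of $S$ has at least one neighbor in every path of $\mathcal{L}$. -}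

module Defs where

open import Data.Nat using (ℕ; _<_; _+_)
open import Data.Bool using (Bool; true; false; if_then_else_)
open import Data.Fin using (Fin; _≟_)
open import Data.Bool.ListAction using (any)
open import Data.List using (List; []; _∷_; length; allFin; lookup; foldr; map)
open import Data.List.Membership.Propositional using (_∈_)
open import Data.List.Relation.Unary.Unique.Propositional using (Unique)
open import Data.Product using (Σ; _×_; _,_; ∃-syntax)
open import Data.Sum using (_⊎_)
open import Data.Empty using (⊥)
open import Relation.Nullary using (¬_; does)
open import Relation.Binary.PropositionalEquality using (_≡_; _≢_)
open import Function.Definitions using (Injective)

record Graph : Set where
  field
    n      : ℕ
    adj    : Fin n → Fin n → Bool
    sym    : ∀ u v → adj u v ≡ adj v u
    irrefl : ∀ v → adj v v ≡ false

open Graph public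

Vtx : Graph → Set
Vtx G = Fin (n G)

Adj : (G : Graph) → Vtx G → Vtx G → Set
Adj G u v = adj G u v ≡ true

-- A path of G, given as a list of its vertices in order: nonempty, no repeated
-- vertices, and for positions i,j the vertices are adjacent iff |i - j| = 1
-- (so the subgraph induced on these vertices is exactly a path).
Consecutive : ∀ {m} → Fin m → Fin m → Set
Consecutive {m} i j = Data.Fin.toℕ i + 1 ≡ Data.Fin.toℕ j ⊎ Data.Fin.toℕ j + 1 ≡ Data.Fin.toℕ i
  where import Data.Fin

IsPath : (G : Graph) → List (Vtx G) → Set
IsPath G p =
  (¬ (p ≡ [])) × Unique p ×
  (∀ i j → Adj G (lookup p i) (lookup p j) → Consecutive i j) ×
  (∀ i j → Consecutive i j → Adj G (lookup p i) (lookup p j))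

Disjoint : {A : Set} → List A → List A → Set
Disjoint p r = ∀ {x} → x ∈ p → x ∈ r → ⊥

IsPolypath : (G : Graph) (w : ℕ) → (Fin w → List (Vtx G)) → Set
IsPolypath G w P = (∀ i → IsPath G (P i)) × (∀ i j → i ≢ j → Disjoint (P i) (P j))

InV : (G : Graph) {w : ℕ} → (Fin w → List (Vtx G)) → Vtx G → Set
InV G P v = ∃[ i ] v ∈ P i

hasNbr : (G : Graph) → Vtx G → List (Vtx G) → Bool
hasNbr G v W = any (adj G v) W

nbrPathCount : (G : Graph) {w : ℕ} → (Fin w → List (Vtx G)) → Fin w → Vtx G → ℕ
nbrPathCount G {w} P i v =
  foldr _+_ 0 (map (λ j → if does (i ≟ j) then 0 else (if hasNbr G v (P j) then 1 else 0)) (allFin w))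

Loose : (G : Graph) (d : ℕ) {w : ℕ} → (Fin w → List (Vtx G)) → Set
Loose G d {w} P = ∀ (i : Fin w) v → v ∈ P i → nbrPathCount G P i v < d

IsCluster : (G : Graph) (s l : ℕ) → (Fin s → Vtx G) → (Fin l → List (Vtx G)) → Set
IsCluster G s l S L =
  Injective _≡_ _≡_ S × IsPolypath G l L ×
  (∀ (a : Fin s) (j : Fin l) → ¬ (S a ∈ L j)) ×
  (∀ (a : Fin s) (j : Fin l) → hasNbr G (S a) (L j) ≡ true)

-- For each position p ≤ l, colour an ordered (l+1)-set e of path indices by
-- whether some vertex of the p-th path of e has neighbours in all l other
-- paths of e. Applying Ramsey's theorem once per position leaves either a
-- large index set H homogeneously "yes" for some p, or one homogeneously "no"
-- for every p. In the first case, split H as p indices, then s indices, then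
-- l − p indices: every middle path contains a vertex seeing all l outer paths,
-- and these s vertices and l paths form a cluster. In the second case any q
-- indices already give an l-loose polypath, since a vertex with neighbours in
-- l other paths, placed at its own position among them, yields a "yes" set.
module Submission where

open import Defs hiding (sym)
open import Data.Nat using (ℕ; zero; suc; _+_; _∸_; _≤_; _<_; z≤n; s≤s; _≤?_)
open import Data.Nat.Properties
  using (≤-refl; ≤-trans; ≤-reflexive; +-mono-≤; +-comm; +-assoc; m≤m+n; m≤n+m; m+[n∸m]≡n;
         m≤n⇒m⊓n≡m; m<1+n⇒m≤n; m<1+n⇒m<n∨m≡n; m<n⇒m<1+n; ≰⇒>; suc-injective; n<1+n)
open import Data.Fin using (Fin; zero; suc; _≟_)
open import Data.Unit using (tt)
open import Data.Bool using (Bool; true; false; if_then_else_)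
import Data.Bool as Bool
open import Data.Bool.Properties using (T-≡)
open import Data.Bool.ListAction using (any; all)
open import Data.List using (List; []; _∷_; _++_; length; map; foldr; lookup; allFin; take; drop; filter; replicate)
open import Data.List.Properties
  using (length-++; length-++-sucʳ; length-++-≤ˡ; length-map; length-take; length-replicate; length-tabulate;
         map-++; map-tabulate; tabulate-lookup)
open import Data.List.Membership.Propositional using (_∈_; _∉_; find; lose)
open import Data.List.Membership.Propositional.Properties using (∈-lookup; ∈-allFin; ∈-insert)
open import Data.List.Relation.Unary.Any using (here; there)
open import Data.List.Relation.Unary.Any.Properties using (any⁺; any⁻)
open import Data.List.Relation.Unary.All using (All)
import Data.List.Relation.Unary.All as All
open import Data.List.Relation.Unary.All.Properties using (all⁺; all⁻; all-filter) renaming (map⁺ to All-map⁺)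
open import Data.List.Relation.Unary.Unique.Propositional using (Unique; []; _∷_)
open import Data.List.Relation.Unary.Unique.Propositional.Properties using (allFin⁺; Unique[x∷xs]⇒x∉xs)
open import Data.List.Relation.Binary.Sublist.Propositional using (_⊆_; []; _∷_; _∷ʳ_; ⊆-refl; ⊆-trans)
open import Data.List.Relation.Binary.Sublist.Propositional.Properties
  using (All-resp-⊆; ++⁺; ++⁺ˡ; ++⁺ʳ; take-⊆; filter-⊆; length-mono-≤; map⁺; []⊆-universal)
open import Data.Product using (Σ; _×_; _,_; ∃-syntax; ∃₂; proj₁; proj₂)
open import Data.Sum using (_⊎_; inj₁; inj₂)
import Data.Sum as Sum
open import Data.Empty using (⊥-elim)
open import Relation.Nullary using (¬_; ¬?; does; yes; no; contradiction; _×-dec_)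
open import Relation.Unary using (Decidable)
open import Relation.Binary.PropositionalEquality
  using (_≡_; _≢_; refl; sym; trans; cong; cong₂; subst; module ≡-Reasoning)
open import Function using (_∘_; Equivalence)
open import Function.Definitions using (Injective)

private
  variable
    A : Set
    x y : A
    xs ys zs : List A

Unique-resp-⊆ : xs ⊆ ys → Unique ys → Unique xs
Unique-resp-⊆ []         []         = []
Unique-resp-⊆ (_ ∷ʳ τ)   (_ ∷ u)    = Unique-resp-⊆ τ u
Unique-resp-⊆ (refl ∷ τ) (x∉ ∷ u)   = All-resp-⊆ τ x∉ ∷ Unique-resp-⊆ τ u

lookup-injective : Unique xs → Injective _≡_ _≡_ (lookup xs)
lookup-injective {xs = _ ∷ _} _        {zero}  {zero}  _  = refl
lookup-injective              (x∉ ∷ _) {zero}  {suc j} eq = ⊥-elim (All.lookup x∉ (∈-lookup j) eq)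
lookup-injective              (x∉ ∷ _) {suc i} {zero}  eq = ⊥-elim (All.lookup x∉ (∈-lookup i) (sym eq))
lookup-injective              (_ ∷ u)  {suc i} {suc j} eq = cong suc (lookup-injective u eq)

map-lookup-allFin : (xs : List A) → map (lookup xs) (allFin (length xs)) ≡ xs
map-lookup-allFin xs = trans (map-tabulate (λ i → i) (lookup xs)) (tabulate-lookup xs)

∉-middle : ∀ xs → Unique (xs ++ y ∷ ys) → y ∉ xs ++ ys
∉-middle []       u           = Unique[x∷xs]⇒x∉xs u
∉-middle (x ∷ xs) (x∉ ∷ _) (here refl) = All.lookup x∉ (∈-insert xs) refl
∉-middle (x ∷ xs) (_ ∷ u)  (there y∈) = ∉-middle xs u y∈

∷-⊆-++ : x ∈ xs → ys ⊆ zs → x ∷ ys ⊆ xs ++ zs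
∷-⊆-++ {xs = _ ∷ xs} (here refl) τ = refl ∷ ++⁺ˡ xs τ
∷-⊆-++ {xs = x ∷ _}  (there x∈) τ = x ∷ʳ ∷-⊆-++ x∈ τ

insert-⊆ : x ∈ zs → ys ⊆ zs → x ∉ ys → ∃₂ λ as bs → ys ≡ as ++ bs × as ++ x ∷ bs ⊆ zs
insert-⊆ (here refl) (_ ∷ʳ τ)    _  = [] , _ , refl , refl ∷ τ
insert-⊆ (there x∈)  (z ∷ʳ τ)    x∉ with insert-⊆ x∈ τ x∉
... | as , bs , eq , σ = as , bs , eq , z ∷ʳ σ
insert-⊆ (here refl) (refl ∷ τ)  x∉ = contradiction (here refl) x∉
insert-⊆ (there x∈)  (refl ∷ τ)  x∉ with insert-⊆ x∈ τ (x∉ ∘ there)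
... | as , bs , eq , σ = _ ∷ as , bs , cong (_ ∷_) eq , refl ∷ σ

splitOff : ∀ m {n} (xs : List A) → m + n ≤ length xs →
           ∃₂ λ ys zs → xs ≡ ys ++ zs × length ys ≡ m × n ≤ length zs
splitOff zero    xs       h       = [] , xs , refl , refl , h
splitOff (suc m) (x ∷ xs) (s≤s h) with splitOff m xs h
... | ys , zs , refl , refl , h′ = x ∷ ys , zs , refl , refl , h′

length-take-≤ : ∀ n (xs : List A) → n ≤ length xs → length (take n xs) ≡ n
length-take-≤ n xs h = trans (length-take n xs) (m≤n⇒m⊓n≡m h)

take-length-++ : ∀ (xs : List A) {ys} → take (length xs) (xs ++ ys) ≡ xs
take-length-++ []       = refl
take-length-++ (x ∷ xs) = cong (x ∷_) (take-length-++ xs)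

drop-length-++ : ∀ (xs : List A) {ys} → drop (length xs) (xs ++ ys) ≡ ys
drop-length-++ []       = refl
drop-length-++ (x ∷ xs) = drop-length-++ xs

sum-≤-length-filter : {P : A → Set} (P? : Decidable P) (f : A → ℕ) →
                      (∀ x → f x ≤ 1) → (∀ x → 1 ≤ f x → P x) →
                      ∀ xs → foldr _+_ 0 (map f xs) ≤ length (filter P? xs)
sum-≤-length-filter P? f f≤1 support []       = z≤n
sum-≤-length-filter P? f f≤1 support (x ∷ xs) with P? x
... | yes _  = +-mono-≤ (f≤1 x) (sum-≤-length-filter P? f f≤1 support xs)
... | no ¬Px = +-mono-≤ (m<1+n⇒m≤n (≰⇒> (¬Px ∘ support x))) (sum-≤-length-filter P? f f≤1 support xs)

-- Ramsey's theorem for sublists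

Homogeneous : (List A → Bool) → ℕ → List A → Bool → Set
Homogeneous χ k ys c = ∀ {zs} → zs ⊆ ys → length zs ≡ k → χ zs ≡ c

MonochromaticSublist : (List A → Bool) → ℕ → Bool → ℕ → List A → Set
MonochromaticSublist χ k c m xs = ∃[ ys ] ys ⊆ xs × m ≤ length ys × Homogeneous χ k ys c

Homogeneous-resp-⊆ : {χ : List A → Bool} {k : ℕ} {c : Bool} →
                     xs ⊆ ys → Homogeneous χ k ys c → Homogeneous χ k xs c
Homogeneous-resp-⊆ τ hom σ = hom (⊆-trans σ τ)

[]-homogeneous : (χ : List A → Bool) (k : ℕ) (c : Bool) → Homogeneous χ (suc k) [] c
[]-homogeneous χ k c [] ()

∷-homogeneous : {χ : List A → Bool} {k : ℕ} {c : Bool} →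
                Homogeneous (χ ∘ (x ∷_)) k ys c → zs ⊆ ys →
                Homogeneous χ (suc k) zs c → Homogeneous χ (suc k) (x ∷ zs) c
∷-homogeneous hx τ hzs (_ ∷ʳ σ)   len = hzs σ len
∷-homogeneous hx τ hzs (refl ∷ σ) len = hx (⊆-trans σ τ) (suc-injective len)

mutual
  ramseyNumber : ℕ → ℕ → ℕ
  ramseyNumber zero    m = m
  ramseyNumber (suc k) m = ramseyNumber₂ k m m

  ramseyNumber₂ : ℕ → ℕ → ℕ → ℕ
  ramseyNumber₂ k zero    b       = 0
  ramseyNumber₂ k (suc a) zero    = 0
  ramseyNumber₂ k (suc a) (suc b) =
    suc (ramseyNumber k (ramseyNumber₂ k a (suc b) + ramseyNumber₂ k (suc a) b))

mutual
  ramsey : ∀ k m (xs : List A) → ramseyNumber k m ≤ length xs →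
           (χ : List A → Bool) → ∃[ c ] MonochromaticSublist χ k c m xs
  ramsey zero m xs h χ = χ [] , xs , ⊆-refl , h , λ { {[]} _ _ → refl }
  ramsey (suc k) m xs h χ with ramsey₂ k m m xs h χ
  ... | inj₁ mono = true , mono
  ... | inj₂ mono = false , mono

  -- Colour each k-sublist of the tail by the colour of its extension by the
  -- head x, pass to a homogeneous part by induction on k, and recurse into it
  -- with the target of that colour lowered by one (x joins in that colour).
  ramsey₂ : ∀ k a b (xs : List A) → ramseyNumber₂ k a b ≤ length xs → (χ : List A → Bool) →
            MonochromaticSublist χ (suc k) true a xs ⊎ MonochromaticSublist χ (suc k) false b xs
  ramsey₂ k zero    b       xs h χ = inj₁ ([] , []⊆-universal xs , z≤n , []-homogeneous χ k true)
  ramsey₂ k (suc a) zero    xs h χ = inj₂ ([] , []⊆-universal xs , z≤n , []-homogeneous χ k false)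
  ramsey₂ k (suc a) (suc b) (x ∷ xs) (s≤s h) χ
    with ramsey k (ramseyNumber₂ k a (suc b) + ramseyNumber₂ k (suc a) b) xs h (χ ∘ (x ∷_))
  ... | true , ys , τ , big , hx with ramsey₂ k a (suc b) ys (≤-trans (m≤m+n _ _) big) χ
  ...   | inj₁ (zs , σ , big′ , hzs) = inj₁ (x ∷ zs , refl ∷ ⊆-trans σ τ , s≤s big′ , ∷-homogeneous hx σ hzs)
  ...   | inj₂ (zs , σ , big′ , hzs) = inj₂ (zs , x ∷ʳ ⊆-trans σ τ , big′ , hzs)
  ramsey₂ k (suc a) (suc b) (x ∷ xs) (s≤s h) χ
      | false , ys , τ , big , hx with ramsey₂ k (suc a) b ys (≤-trans (m≤n+m _ _) big) χ
  ...   | inj₁ (zs , σ , big′ , hzs) = inj₁ (zs , x ∷ʳ ⊆-trans σ τ , big′ , hzs)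
  ...   | inj₂ (zs , σ , big′ , hzs) = inj₂ (x ∷ zs , refl ∷ ⊆-trans σ τ , s≤s big′ , ∷-homogeneous hx σ hzs)

m≤ramseyNumber : ∀ k m → m ≤ ramseyNumber k m
m≤ramseyNumber k m with ramsey k m (replicate (ramseyNumber k m) tt)
                               (≤-reflexive (sym (length-replicate _))) (λ _ → true)
... | _ , ys , τ , big , _ = ≤-trans big (≤-trans (length-mono-≤ τ) (≤-reflexive (length-replicate _)))

iteratedRamseyNumber : ℕ → ℕ → ℕ → ℕ
iteratedRamseyNumber k m zero    = m
iteratedRamseyNumber k m (suc r) = ramseyNumber k (iteratedRamseyNumber k m r)

m≤iteratedRamseyNumber : ∀ k m r → m ≤ iteratedRamseyNumber k m r
m≤iteratedRamseyNumber k m zero    = ≤-refl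
m≤iteratedRamseyNumber k m (suc r) = ≤-trans (m≤iteratedRamseyNumber k m r) (m≤ramseyNumber k _)

ramsey-iterated : ∀ k m r (χ : ℕ → List A → Bool) (xs : List A) → iteratedRamseyNumber k m r ≤ length xs →
                  (∃[ p ] p < r × MonochromaticSublist (χ p) k true m xs)
                  ⊎ (∃[ ys ] ys ⊆ xs × m ≤ length ys × ∀ p → p < r → Homogeneous (χ p) k ys false)
ramsey-iterated k m zero    χ xs h = inj₂ (xs , ⊆-refl , h , λ _ ())
ramsey-iterated k m (suc r) χ xs h with ramsey k (iteratedRamseyNumber k m r) xs h (χ r)
... | true  , ys , τ , big , hom = inj₁ (r , n<1+n r , ys , τ , ≤-trans (m≤iteratedRamseyNumber k m r) big , hom)
... | false , ys , τ , big , hom with ramsey-iterated k m r χ ys big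
...   | inj₁ (p , p<r , zs , σ , big′ , hzs) = inj₁ (p , m<n⇒m<1+n p<r , zs , ⊆-trans σ τ , big′ , hzs)
...   | inj₂ (zs , σ , big′ , hzs) = inj₂ (zs , ⊆-trans σ τ , big′ , all-false)
  where
    all-false : ∀ p → p < suc r → Homogeneous (χ p) k zs false
    all-false p p<1+r with m<1+n⇒m<n∨m≡n p<1+r
    ... | inj₁ p<r  = hzs p p<r
    ... | inj₂ refl = Homogeneous-resp-⊆ σ hom

-- Polypaths

module _ (G : Graph) where

  polypath-disjoint : ∀ {w} {P : Fin w → List (Vtx G)} → IsPolypath G w P →
                      ∀ {i j v} → v ∈ P i → v ∈ P j → i ≡ j
  polypath-disjoint (_ , disjoint) {i} {j} v∈i v∈j with i ≟ j
  ... | yes i≡j = i≡j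
  ... | no  i≢j = ⊥-elim (disjoint i j i≢j v∈i v∈j)

  polypath-∘ : ∀ {w m} {P : Fin w → List (Vtx G)} → IsPolypath G w P →
               (κ : Fin m → Fin w) → Injective _≡_ _≡_ κ → IsPolypath G m (λ j → P (κ j))
  polypath-∘ (paths , disjoint) κ κ-injective =
    (λ j → paths (κ j)) , λ i j i≢j → disjoint (κ i) (κ j) (i≢j ∘ κ-injective)

  neighbourPaths : ∀ {w l} (Q : Fin w → List (Vtx G)) i v → l ≤ nbrPathCount G Q i v →
                   ∃[ J ] J ⊆ allFin w × length J ≡ l × All (λ j → i ≢ j × hasNbr G v (Q j) ≡ true) J
  neighbourPaths {w} {l} Q i v l≤count =
    take l F , ⊆-trans (take-⊆ l F) (filter-⊆ counted? (allFin w)) ,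
    length-take-≤ l F (≤-trans l≤count (sum-≤-length-filter counted? f f≤1 support (allFin w))) ,
    All-resp-⊆ (take-⊆ l F) (all-filter counted? (allFin w))
    where
      f : Fin w → ℕ
      f j = if does (i ≟ j) then 0 else (if hasNbr G v (Q j) then 1 else 0)
      counted? : Decidable (λ j → i ≢ j × hasNbr G v (Q j) ≡ true)
      counted? j = ¬? (i ≟ j) ×-dec (hasNbr G v (Q j) Bool.≟ true)
      F : List (Fin w)
      F = filter counted? (allFin w)
      f≤1 : ∀ j → f j ≤ 1
      f≤1 j with i ≟ j | hasNbr G v (Q j)
      ... | yes _ | _     = z≤n
      ... | no  _ | true  = ≤-refl
      ... | no  _ | false = z≤n
      support : ∀ j → 1 ≤ f j → i ≢ j × hasNbr G v (Q j) ≡ true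
      support j 1≤ with i ≟ j | hasNbr G v (Q j)
      ... | yes _   | _     = contradiction 1≤ λ ()
      ... | no  i≢j | true  = i≢j , refl
      ... | no  _   | false = contradiction 1≤ λ ()

module _ (G : Graph) {σ : ℕ} (P : Fin σ → List (Vtx G)) where

  seesAll : Vtx G → List (Fin σ) → Bool
  seesAll v = all (λ j → hasNbr G v (P j))

  pivotSeesSplit : List (Fin σ) → List (Fin σ) → Bool
  pivotSeesSplit as []       = false
  pivotSeesSplit as (y ∷ bs) = any (λ v → seesAll v (as ++ bs)) (P y)

  pivotSees : ℕ → List (Fin σ) → Bool
  pivotSees p e = pivotSeesSplit (take p e) (drop p e)

  pivotSees-++ : ∀ as y bs → pivotSees (length as) (as ++ y ∷ bs) ≡ any (λ v → seesAll v (as ++ bs)) (P y)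
  pivotSees-++ as y bs = cong₂ pivotSeesSplit (take-length-++ as) (drop-length-++ as)

  pivotSees⇒witness : ∀ as y bs → pivotSees (length as) (as ++ y ∷ bs) ≡ true →
                      ∃[ v ] v ∈ P y × All (λ j → hasNbr G v (P j) ≡ true) (as ++ bs)
  pivotSees⇒witness as y bs coloured with find (any⁻ _ (P y) (Equivalence.from T-≡ (trans (sym (pivotSees-++ as y bs)) coloured)))
  ... | v , v∈ , sees = v , v∈ , All.map (Equivalence.to T-≡) (all⁺ _ (as ++ bs) sees)

  witness⇒pivotSees : ∀ as y bs {v} → v ∈ P y → All (λ j → hasNbr G v (P j) ≡ true) (as ++ bs) →
                      pivotSees (length as) (as ++ y ∷ bs) ≡ true
  witness⇒pivotSees as y bs v∈ sees =
    trans (pivotSees-++ as y bs) (Equivalence.to T-≡ (any⁺ _ (lose v∈ (all⁻ _ (All.map (Equivalence.from T-≡) sees)))))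

  ClusterIn : ℕ → ℕ → Set
  ClusterIn l s = Σ (Fin s → Vtx G) λ S → Σ (Fin l → Fin σ) λ ι →
    IsCluster G s l S (λ j → P (ι j)) × Injective _≡_ _≡_ ι × (∀ a → InV G P (S a))

  LooseSubpolypath : ℕ → ℕ → Set
  LooseSubpolypath l q = Σ (Fin q → Fin σ) λ κ →
    Injective _≡_ _≡_ κ × IsPolypath G q (λ j → P (κ j)) × Loose G l (λ j → P (κ j))

  manyNeighbours⇒pivotSees : ∀ {l} T (i : Fin (length T)) {v} → v ∈ P (lookup T i) →
    l ≤ nbrPathCount G (λ j → P (lookup T j)) i v →
    ∃₂ λ p E → p < suc l × E ⊆ T × length E ≡ suc l × pivotSees p E ≡ true
  manyNeighbours⇒pivotSees {l} T i {v} v∈ l≤count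
    with neighbourPaths G (λ j → P (lookup T j)) i v l≤count
  ... | J , J⊆ , refl , counted
    with insert-⊆ (∈-allFin i) J⊆ (λ i∈J → proj₁ (All.lookup counted i∈J) refl)
  ... | as , bs , refl , E⊆ =
    length (map κ as) , map κ as ++ κ i ∷ map κ bs ,
    s≤s (≤-trans (≤-reflexive (length-map κ as)) (length-++-≤ˡ as)) ,
    subst (_⊆ T) (map-++ κ as (i ∷ bs)) (subst (map κ (as ++ i ∷ bs) ⊆_) (map-lookup-allFin T) (map⁺ κ E⊆)) ,
    length-E ,
    witness⇒pivotSees (map κ as) (κ i) (map κ bs) v∈
      (subst (All _) (map-++ κ as bs) (All-map⁺ (All.map proj₂ counted)))
    where
      κ : Fin (length T) → Fin σ
      κ = lookup T
      length-E : length (map κ as ++ κ i ∷ map κ bs) ≡ suc (length (as ++ bs))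
      length-E = begin
        length (map κ as ++ κ i ∷ map κ bs) ≡⟨ cong length (map-++ κ as (i ∷ bs)) ⟨
        length (map κ (as ++ i ∷ bs))       ≡⟨ length-map κ (as ++ i ∷ bs) ⟩
        length (as ++ i ∷ bs)               ≡⟨ length-++-sucʳ as i bs ⟩
        suc (length (as ++ bs))             ∎
        where open ≡-Reasoning

  module _ (poly : IsPolypath G σ P) where

    clusterFromSplit : ∀ as ms bs → Unique (as ++ ms ++ bs) →
      (∀ {y} → y ∈ ms → ∃[ v ] v ∈ P y × All (λ j → hasNbr G v (P j) ≡ true) (as ++ bs)) →
      ClusterIn (length (as ++ bs)) (length ms)
    clusterFromSplit as ms bs unique witness =
      S , ι , (S-injective , polypath-∘ G poly ι ι-injective , S∉L , S-sees-L) , ι-injective , λ k → origin k , S∈P k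
      where
        origin : Fin (length ms) → Fin σ
        origin = lookup ms
        ι : Fin (length (as ++ bs)) → Fin σ
        ι = lookup (as ++ bs)
        S : Fin (length ms) → Vtx G
        S k = proj₁ (witness (∈-lookup k))
        S∈P : ∀ k → S k ∈ P (origin k)
        S∈P k = proj₁ (proj₂ (witness (∈-lookup k)))
        ι-injective : Injective _≡_ _≡_ ι
        ι-injective = lookup-injective (Unique-resp-⊆ (++⁺ (⊆-refl {x = as}) (++⁺ˡ ms ⊆-refl)) unique)
        S-injective : Injective _≡_ _≡_ S
        S-injective {k} {k′} eq = lookup-injective (Unique-resp-⊆ (++⁺ˡ as (++⁺ʳ bs ⊆-refl)) unique)
          (polypath-disjoint G poly (S∈P k) (subst (_∈ P (origin k′)) (sym eq) (S∈P k′)))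
        S∉L : ∀ k j → ¬ (S k ∈ P (ι j))
        S∉L k j S∈ = ∉-middle as (Unique-resp-⊆ (++⁺ (⊆-refl {x = as}) (∷-⊆-++ (∈-lookup k) ⊆-refl)) unique)
          (subst (_∈ as ++ bs) (polypath-disjoint G poly S∈ (S∈P k)) (∈-lookup j))
        S-sees-L : ∀ k j → hasNbr G (S k) (P (ι j)) ≡ true
        S-sees-L k j = All.lookup (proj₂ (proj₂ (witness (∈-lookup k)))) (∈-lookup j)

    homogeneous-true⇒cluster : ∀ {l s p} H → H ⊆ allFin σ → p ≤ l → l + s ≤ length H →
                               Homogeneous (pivotSees p) (suc l) H true → ClusterIn l s
    homogeneous-true⇒cluster {l} {s} {p} H H⊆ p≤l big hom with splitOff p H (≤-trans (≤-reflexive split-size) big)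
      where
        split-size : p + (s + (l ∸ p)) ≡ l + s
        split-size = begin
          p + (s + (l ∸ p)) ≡⟨ cong (p +_) (+-comm s (l ∸ p)) ⟩
          p + (l ∸ p + s)   ≡⟨ +-assoc p (l ∸ p) s ⟨
          p + (l ∸ p) + s   ≡⟨ cong (_+ s) (m+[n∸m]≡n p≤l) ⟩
          l + s             ∎
          where open ≡-Reasoning
    ... | as , rest , refl , refl , big₁ with splitOff s rest big₁
    ... | ms , rest′ , refl , refl , big₂ =
      subst (λ l′ → ClusterIn l′ (length ms)) length-as++bs
        (clusterFromSplit as ms bs (Unique-resp-⊆ (⊆-trans split⊆ H⊆) (allFin⁺ σ)) witness)
      where
        bs : List (Fin σ)
        bs = take (l ∸ length as) rest′
        split⊆ : as ++ ms ++ bs ⊆ as ++ ms ++ rest′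
        split⊆ = ++⁺ (⊆-refl {x = as}) (++⁺ (⊆-refl {x = ms}) (take-⊆ _ rest′))
        length-as++bs : length (as ++ bs) ≡ l
        length-as++bs = trans (length-++ as)
          (trans (cong (length as +_) (length-take-≤ _ rest′ big₂)) (m+[n∸m]≡n p≤l))
        witness : ∀ {y} → y ∈ ms → ∃[ v ] v ∈ P y × All (λ j → hasNbr G v (P j) ≡ true) (as ++ bs)
        witness {y} y∈ = pivotSees⇒witness as y bs
          (hom (++⁺ (⊆-refl {x = as}) (∷-⊆-++ y∈ (take-⊆ _ rest′)))
               (trans (length-++-sucʳ as y bs) (cong suc length-as++bs)))

    homogeneous-false⇒loose : ∀ {l q} T → T ⊆ allFin σ → q ≤ length T →
                              (∀ p → p < suc l → Homogeneous (pivotSees p) (suc l) T false) →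
                              LooseSubpolypath l q
    homogeneous-false⇒loose {l} {q} T T⊆ q≤ hom =
      subst (LooseSubpolypath l) (length-take-≤ q T q≤)
        (loose-prefix (take q T) (⊆-trans (take-⊆ q T) T⊆)
          λ p p<1+l → Homogeneous-resp-⊆ (take-⊆ q T) (hom p p<1+l))
      where
        loose-prefix : ∀ T′ → T′ ⊆ allFin σ → (∀ p → p < suc l → Homogeneous (pivotSees p) (suc l) T′ false) →
                       LooseSubpolypath l (length T′)
        loose-prefix T′ T′⊆ hom′ = κ , κ-injective , polypath-∘ G poly κ κ-injective , loose
          where
            κ : Fin (length T′) → Fin σ
            κ = lookup T′
            κ-injective : Injective _≡_ _≡_ κ
            κ-injective = lookup-injective (Unique-resp-⊆ T′⊆ (allFin⁺ σ))
            loose : Loose G l (λ j → P (κ j))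
            loose i v v∈ with l ≤? nbrPathCount G (λ j → P (κ j)) i v
            ... | no  l≰count = ≰⇒> l≰count
            ... | yes l≤count with manyNeighbours⇒pivotSees T′ i v∈ l≤count
            ...   | p , E , p<1+l , E⊆ , length-E , seen =
              contradiction (trans (sym seen) (hom′ p p<1+l E⊆ length-E)) λ ()

lemma5p4 : (l q s : ℕ) → ∃[ σ ] ((G : Graph) (P : Fin σ → List (Vtx G)) → IsPolypath G σ P →
    (Σ (Fin s → Vtx G) λ S → Σ (Fin l → Fin σ) λ ι → (IsCluster G s l S (λ j → P (ι j)) × Injective _≡_ _≡_ ι × (∀ a → InV G P (S a))))
    ⊎ (Σ (Fin q → Fin σ) λ κ → (Injective _≡_ _≡_ κ × IsPolypath G q (λ j → P (κ j)) × Loose G l (λ j → P (κ j)))))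
lemma5p4 l q s = σ , λ G P poly →
  Sum.map (λ (p , p<1+l , H , H⊆ , big , hom) →
             homogeneous-true⇒cluster G P poly H H⊆ (m<1+n⇒m≤n p<1+l) (≤-trans (m≤n+m (l + s) q) big) hom)
          (λ (T , T⊆ , big , hom) → homogeneous-false⇒loose G P poly T T⊆ (≤-trans (m≤m+n q (l + s)) big) hom)
          (ramsey-iterated (suc l) (q + (l + s)) (suc l) (pivotSees G P) (allFin σ)
            (≤-reflexive (sym (length-tabulate (λ i → i)))))
  where
    σ : ℕ
    σ = iteratedRamseyNumber (suc l) (q + (l + s)) (suc l)
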